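{- Let $T$ be a tree on $n$ nodes and run the modified top tree construction algorithm described in the context with parameter $\alpha=10/9$. Then after the $t^\text{th}$ iteration, the tree $\widetilde T$ contains $O(n/\alpha^{t+1})$ clusters (edges), with the hidden constant independent of $n$ and $t$.
   Context: Trees are rooted and ordered, with node labels from an alphabet $\Sigma$. For a node $v$ with children $v_1,\dots,v_k$, $T(v)$ is the subtree rooted at $v$, $F(v)=T(v_1)\cup\dots\cup T(v_k)$, and $T(v,v_s,v_r)=\{v\}\cup T(v_s)\cup\dots\cup T(v_r)$. A cluster is either $T(v,v_s,v_r)$ (top boundary node $v$) or $T(v,v_s,v_r)\setminus F(u)$ for $u\in T(v,v_s,v_r)\setminus\{v\}$ (top boundary $v$, bottom boundary $u$). Two edge-disjoint clusters sharing exactly one boundary node whose union is a cluster can be merged into the union. The size of a cluster is the number of edges of $T$ it contains. The original algorithm (Bille et al.) maintains an ordered tree $\widetilde T$, initially $T$, whose edges correspond to the current clusters; merging two edges of $\widetilde T$ merges the corresponding clusters and replaces them by one edge (a vertical merge of $(v_1,v_2),(v_2,v_3)$ removes $v_2$ and creates edge $(v_1,v_3)$; a horizontal merge of two sibling edges below $v$, one of which goes to a leaf, removes that leaf). One iteration of the original algorithm consists of: (1) Horizontal merges: for each node $v$ of $\widetilde T$ with $k\ge2$ children $v_1,\dots,v_k$, for $i=1,\dots,\lfloor k/2\rfloor$ merge $(v,v_{2i-1})$ and $(v,v_{2i})$ if $v_{2i-1}$ or $v_{2i}$ is a leaf; if $k$ is odd, $v_k$ is a leaf and $v_{k-2},v_{k-1}$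 are non-leaves, also merge $(v,v_{k-1})$ and $(v,v_k)$. (2) Vertical merges: for each maximal path $v_1,\dots,v_p$ with $v_{i+1}$ the parent of $v_i$ and $v_2,\dots,v_{p-1}$ having a single child: if $p$ is even merge consecutive pairs $\{(v_1,v_2),(v_2,v_3)\},\{(v_3,v_4),(v_4,v_5)\},\dots$ up to the edge $(v_{p-2},v_{p-1})$; if $p$ is odd merge consecutive pairs up to the edge $(v_{p-3},v_{p-2})$, and if $(v_{p-1},v_p)$ was not merged in step (1) also merge $\{(v_{p-2},v_{p-1}),(v_{p-1},v_p)\}$. The modified algorithm with parameter $\alpha>1$: for $t=1,2,\dots$ (until a single cluster remains), in the $t^\text{th}$ iteration it computes all merges that one iteration of the original algorithm (both steps) would perform on the current $\widetilde T$, and applies only those merges in which both participating clusters have size at most $\alpha^t$. -}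

module Defs where

open import Data.Nat using (ℕ; zero; suc; _+_; _*_; _^_; _≤ᵇ_; _≡ᵇ_)
open import Data.Bool using (Bool; true; false; _∧_; _∨_; not; if_then_else_)
open import Data.List using (List; []; _∷_; _++_; length; concatMap)
open import Data.Product using (_×_; _,_)
open import Data.Maybe using (Maybe; just; nothing; is-just)

data OTree (A : Set) : Set where
  node : A → List (OTree A) → OTree A

mutual
  nodes : {A : Set} → OTree A → ℕ
  nodes (node _ ts) = suc (nodesL ts)

  nodesL : {A : Set} → List (OTree A) → ℕ
  nodesL []       = 0
  nodesL (t ∷ ts) = nodes t + nodesL ts

-- The cluster tree T~ : an ordered tree whose edges are labelled by the
-- size (number of edges of T) of the corresponding cluster.

data WTree : Set where
  wnode : List (ℕ × WTree) → WTree

mutual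
  -- number of edges of T~ = number of clusters
  edgesW : WTree → ℕ
  edgesW (wnode cs) = edgesL cs

  edgesL : List (ℕ × WTree) → ℕ
  edgesL []             = 0
  edgesL ((_ , s) ∷ cs) = suc (edgesW s + edgesL cs)

mutual
  toW : {A : Set} → OTree A → WTree
  toW (node _ ts) = wnode (toWs ts)

  toWs : {A : Set} → List (OTree A) → List (ℕ × WTree)
  toWs []       = []
  toWs (t ∷ ts) = (1 , toW t) ∷ toWs ts

isLeaf : WTree → Bool
isLeaf (wnode []) = true
isLeaf (wnode (_ ∷ _)) = false

-- size s ≤ α^t with α = 10/9, i.e. s * 9^t ≤ 10^t
small : ℕ → ℕ → Bool
small t s = (s * 9 ^ t) ≤ᵇ (10 ^ t)

-- Result of processing (bottom-up) the subtree of T~ at a node c: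
--  * closed : the new subtree at c, assuming c is kept;
--  * open   : if c has a single child after the (ideal) horizontal step and
--             the edge below c is at an odd position of its maximal path
--             (counted from the bottom), its cluster size and the new subtree
--             below it; this edge is to be vertically merged with the edge
--             above c (which then removes c).

record Result : Set where
  constructor mkResult
  field
    closed : WTree
    open?  : Maybe (ℕ × WTree)
open Result public

-- which of the two horizontally merged edges goes to the removed leaf
data Side : Set where
  leftLeaf rightLeaf : Side

-- edges of T~ after the (ideal) horizontal step of the original algorithm
data E1 : Set where
  single : ℕ → Result → E1                 -- unmerged edge (size, result below)
  pair   : ℕ → ℕ → Side → Result → E1      -- horizontal merge (sizes l r, removed side, surviving child)

-- child edge before the horizontal step: (size, child is a leaf, result below)
Item : Set
Item = ℕ × Bool × Result

mkPair : Item → Item → E1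
mkPair (w₁ , l₁ , r₁) (w₂ , l₂ , r₂) =
  if l₂ then pair w₁ w₂ rightLeaf r₁ else pair w₁ w₂ leftLeaf r₂

leafI : Item → Bool
leafI (_ , l , _) = l

singleI : Item → E1
singleI (w , _ , r) = single w r

pr : Item → Item → List E1
pr x y = if leafI x ∨ leafI y then mkPair x y ∷ [] else singleI x ∷ singleI y ∷ []

-- step (1) of the original algorithm on the child list of a node
group : List Item → List E1
group []                    = []
group (x ∷ [])              = singleI x ∷ []
group (x ∷ y ∷ [])          = pr x y
group (x ∷ y ∷ z ∷ [])      =
  if leafI x ∨ leafI y then mkPair x y ∷ singleI z ∷ []
  else (if leafI z then singleI x ∷ mkPair y z ∷ []
        else singleI x ∷ singleI y ∷ singleI z ∷ [])
group (x ∷ y ∷ z ∷ w ∷ rest) = pr x y ++ group (z ∷ w ∷ rest)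

size1 : E1 → ℕ
size1 (single w _)     = w
size1 (pair w₁ w₂ _ _) = w₁ + w₂

isPair : E1 → Bool
isPair (single _ _)   = false
isPair (pair _ _ _ _) = true

survivor : E1 → Result
survivor (single _ r)   = r
survivor (pair _ _ _ r) = r

-- the new edges realising a step-(1) edge when it is not vertically merged;
-- a horizontal merge is applied only if both clusters have size ≤ α^t
realize : ℕ → E1 → WTree → List (ℕ × WTree)
realize t (single w _) S = (w , S) ∷ []
realize t (pair w₁ w₂ side _) S =
  if small t w₁ ∧ small t w₂ then (w₁ + w₂ , S) ∷ []
  else realizeSplit side
  where
    realizeSplit : Side → List (ℕ × WTree)
    realizeSplit rightLeaf = (w₁ , S) ∷ (w₂ , wnode []) ∷ []
    realizeSplit leftLeaf  = (w₁ , wnode []) ∷ (w₂ , S) ∷ []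

combine : ℕ → Bool → List E1 → Result
combine t root gs = mkResult (wnode (concatMap edgesOf gs)) openU
  where
    uSingle : Bool
    uSingle = length gs ≡ᵇ 1
    -- the edges below this node are the top edges of their maximal paths
    top : Bool
    top = not (uSingle ∧ not root)
    -- step (2): is the vertical merge (edge below child, edge g) selected?
    selected : E1 → Bool
    selected g = is-just (open? (survivor g)) ∧ not (top ∧ isPair g)
    edgesOf : E1 → List (ℕ × WTree)
    edgesOf g with open? (survivor g)
    ... | nothing = realize t g (closed (survivor g))
    ... | just (s , D) =
      if not (top ∧ isPair g) ∧ small t s ∧ small t (size1 g)
      then (s + size1 g , D) ∷ []
      else realize t g (closed (survivor g))
    openOf : List E1 → Maybe (ℕ × WTree)
    openOf (g ∷ []) = if selected g then nothing else just (size1 g , closed (survivor g))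
    openOf _        = nothing
    openU : Maybe (ℕ × WTree)
    openU = openOf gs

mutual
  process : ℕ → Bool → WTree → Result
  process t root (wnode cs) = combine t root (group (items t cs))

  items : ℕ → List (ℕ × WTree) → List Item
  items t []             = []
  items t ((w , s) ∷ cs) = (w , isLeaf s , process t false s) ∷ items t cs

iteration : ℕ → WTree → WTree
iteration t T = closed (process t true T)

run : ℕ → WTree → WTree
run zero    T = T
run (suc k) T = iteration (suc k) (run k T)

-- Write E_k for the number of clusters after k iterations and n for |T|.
-- 1. Weight: the total size of all clusters never increases, so it stays < n.
-- 2. Big clusters (size > α^t / 2) are few: their number B satisfies B · α^t ≤ 2n.
-- 3. Contraction: on a tree with at least two edges, 6 E_t ≤ 5 E_(t-1) + 6 B.
--    This is an amortized argument: every edge carries credit 5, every big cluster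
--    credit 6, and bottom-up every non-root subtree pays 6 per edge it keeps plus a
--    charge for the edge it hands up for a vertical merge.  A merge of the original
--    algorithm is skipped only for a cluster that is not small, and such a cluster is
--    big, so its credit pays for the edge that survives.
-- 4. Induction on k: E_k · 10^k ≤ 27 n 9^k while at least two edges remain (trees
--    with at most one edge stay so); one more factor 10/9 gives the theorem.
module Submission where

open import Defs
open import Data.Nat using (ℕ; zero; suc; _+_; _*_; _^_; _≤_; _∸_; _≰_; _≡ᵇ_; _⊔_; z≤n; s≤s; _≤?_)
open import Data.Nat.Properties
open import Data.Nat.ListAction using (sum)
open import Data.Nat.ListAction.Properties using (sum-++)
open import Data.Nat.Tactic.RingSolver using (solve-∀; solve)
open import Data.Bool using (Bool; true; false; _∧_; _∨_; not; if_then_else_; T)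
open import Data.Bool.Properties using (∧-zeroʳ; T-≡; not-¬)
open import Data.List using (List; []; _∷_; _++_; length; concat; concatMap; map)
open import Data.List.Properties using (++-identityʳ; map-++; length-++; concatMap-cong; concat-++)
open import Data.Maybe using (Maybe; just; nothing; is-just)
open import Data.Product using (∃-syntax; _×_; _,_; proj₁)
open import Data.Sum using (_⊎_; inj₁; inj₂; fromInj₂)
open import Data.Unit using (⊤; tt)
open import Data.Empty using (⊥-elim)
open import Function.Bundles using (Equivalence)
open import Relation.Nullary using (yes; no)
open import Relation.Binary.PropositionalEquality

if-elim : ∀ {A : Set} (P : A → Set) (b : Bool) {x y : A} → P x → P y → P (if b then x else y)
if-elim P true  px py = px
if-elim P false px py = py

≤-shift : ∀ {A P Q B} → P ≤ Q → (k extra : ℕ) → A ≡ P + k → Q + k + extra ≡ B → A ≤ B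
≤-shift {Q = Q} P≤Q k extra refl refl = ≤-trans (+-monoˡ-≤ k P≤Q) (m≤m+n (Q + k) extra)

-- The local definitions of `combine`, named so that proofs can refer to them.

-- Whether the edges below a node are the top edges of their maximal paths:
-- at the root and at nodes with at least two edges after step (1).
pathTop : Bool → List E1 → Bool
pathTop root gs = not ((length gs ≡ᵇ 1) ∧ not root)

-- Whether step (2) merges the edge g with the path edge below it (a horizontally
-- merged pair that starts a path is not merged vertically in the same iteration).
scheduled : Bool → E1 → Bool
scheduled top g = not (top ∧ isPair g)

newEdges : ℕ → Bool → E1 → Maybe (ℕ × WTree) → List (ℕ × WTree)
newEdges t top g nothing         = realize t g (closed (survivor g))
newEdges t top g (just (s , D)) =
  if scheduled top g ∧ small t s ∧ small t (size1 g)
  then (s + size1 g , D) ∷ []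
  else realize t g (closed (survivor g))

edgesFrom : ℕ → Bool → E1 → List (ℕ × WTree)
edgesFrom t top g = newEdges t top g (open? (survivor g))

-- The edge a node with a single step-(1) edge hands up to be merged with the
-- edge above it, if the vertical merge below it was not scheduled.
pending : Bool → List E1 → Maybe (ℕ × WTree)
pending top (g ∷ []) =
  if is-just (open? (survivor g)) ∧ scheduled top g then nothing else just (size1 g , closed (survivor g))
pending top _ = nothing

combine-unfold : ∀ t root gs →
  combine t root gs ≡ mkResult (wnode (concatMap (edgesFrom t (pathTop root gs)) gs)) (pending (pathTop root gs) gs)
combine-unfold t root gs = cong₂ mkResult (cong wnode (concatMap-cong (λ where
    (single w (mkResult c nothing))       → refl
    (single w (mkResult c (just _)))      → refl
    (pair w₁ w₂ sd (mkResult c nothing))  → refl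
    (pair w₁ w₂ sd (mkResult c (just _))) → refl) gs)) (same-pending gs)
  where
  same-pending : ∀ hs → open? (combine t root hs) ≡ pending (pathTop root hs) hs
  same-pending []          = refl
  same-pending (g ∷ [])    = refl
  same-pending (g ∷ _ ∷ _) = refl

-- Small and big clusters

small-sound : ∀ t w → small t w ≡ true → w * 9 ^ t ≤ 10 ^ t
small-sound t w e = ≤ᵇ⇒≤ (w * 9 ^ t) (10 ^ t) (Equivalence.from T-≡ e)

small-complete : ∀ t w → w * 9 ^ t ≤ 10 ^ t → small t w ≡ true
small-complete t w h = Equivalence.to T-≡ (≤⇒≤ᵇ h)

big : ℕ → ℕ → ℕ
big t w = if small t (2 * w) then 0 else 1

big-of-large : ∀ t w → small t w ≡ false → big t w ≡ 1
big-of-large t w large with small t (2 * w) in half-small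
... | false = refl
... | true  = ⊥-elim (not-¬ w-small large)
  where
  w-small : small t w ≡ true
  w-small = small-complete t w (≤-trans (*-monoˡ-≤ (9 ^ t) (m≤m+n w (w + 0))) (small-sound t (2 * w) half-small))

big-size : ∀ t w → big t w * 10 ^ t ≤ 2 * w * 9 ^ t
big-size t w with small t (2 * w) in half-small
... | true  = z≤n
... | false = ≤-trans (≤-reflexive (*-identityˡ (10 ^ t))) (<⇒≤ (≰⇒> not-half-small))
  where
  not-half-small : 2 * w * 9 ^ t ≰ 10 ^ t
  not-half-small h = not-¬ (small-complete t (2 * w) h) half-small

-- Weights

mutual
  weight : WTree → ℕ
  weight (wnode cs) = weightL cs

  weightL : List (ℕ × WTree) → ℕ
  weightL []             = 0
  weightL ((w , s) ∷ cs) = (w + weight s) + weightL cs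

weightL-++ : ∀ xs ys → weightL (xs ++ ys) ≡ weightL xs + weightL ys
weightL-++ []             ys = refl
weightL-++ ((w , s) ∷ xs) ys = trans (cong (w + weight s +_) (weightL-++ xs ys))
                                     (sym (+-assoc (w + weight s) (weightL xs) (weightL ys)))

-- Weights of the pieces handled while processing a node: the pending edge, a
-- processed subtree (its result and its pending edge overlap, hence the maximum),
-- a child edge, and a step-(1) edge with the subtree it keeps.
openWeight : Maybe (ℕ × WTree) → ℕ
openWeight nothing        = 0
openWeight (just (s , D)) = s + weight D

resultWeight : Result → ℕ
resultWeight r = weight (closed r) ⊔ openWeight (open? r)

itemWeight : Item → ℕ
itemWeight (w , _ , r) = w + resultWeight r

stepWeight : E1 → ℕ
stepWeight g = size1 g + resultWeight (survivor g)

realize-weight : ∀ t g S → weightL (realize t g S) ≤ size1 g + weight S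
realize-weight t (single w r) S = ≤-reflexive (+-identityʳ (w + weight S))
realize-weight t (pair w₁ w₂ rightLeaf r) S =
  if-elim (λ cs → weightL cs ≤ (w₁ + w₂) + weight S) (small t w₁ ∧ small t w₂)
    (≤-reflexive (+-identityʳ (w₁ + w₂ + weight S)))
    (≤-reflexive (rearrange w₁ w₂ (weight S)))
  where
  rearrange : ∀ a b c → (a + c) + ((b + 0) + 0) ≡ (a + b) + c
  rearrange = solve-∀
realize-weight t (pair w₁ w₂ leftLeaf r) S =
  if-elim (λ cs → weightL cs ≤ (w₁ + w₂) + weight S) (small t w₁ ∧ small t w₂)
    (≤-reflexive (+-identityʳ (w₁ + w₂ + weight S)))
    (≤-reflexive (rearrange w₁ w₂ (weight S)))
  where
  rearrange : ∀ a b c → (a + 0) + ((b + c) + 0) ≡ (a + b) + c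
  rearrange = solve-∀

newEdges-weight : ∀ t top g m {V} → weight (closed (survivor g)) ≤ V → openWeight m ≤ V →
                  weightL (newEdges t top g m) ≤ size1 g + V
newEdges-weight t top g nothing closed≤ _ =
  ≤-trans (realize-weight t g (closed (survivor g))) (+-monoʳ-≤ (size1 g) closed≤)
newEdges-weight t top g (just (s , D)) {V} closed≤ open≤ =
  if-elim (λ cs → weightL cs ≤ size1 g + V) (scheduled top g ∧ small t s ∧ small t (size1 g))
    (≤-trans (≤-reflexive (rearrange s (size1 g) (weight D))) (+-monoʳ-≤ (size1 g) open≤))
    (newEdges-weight t top g nothing closed≤ z≤n)
  where
  rearrange : ∀ a b c → (a + b + c) + 0 ≡ b + (a + c)
  rearrange = solve-∀

edgesFrom-weight : ∀ t top g → weightL (edgesFrom t top g) ≤ stepWeight g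
edgesFrom-weight t top g =
  newEdges-weight t top g (open? (survivor g)) (m≤m⊔n _ _) (m≤n⊔m (weight (closed (survivor g))) _)

module _ (μ : Item → ℕ) (ν : E1 → ℕ)
         (single≤ : ∀ x → ν (singleI x) ≤ μ x)
         (pair≤ : ∀ x y → ν (mkPair x y) ≤ μ x + μ y) where

  private
    rearrange₂ : ∀ a b → a + (b + 0) ≡ a + b
    rearrange₂ a b = cong (a +_) (+-identityʳ b)

  pr-sum : ∀ x y → sum (map ν (pr x y)) ≤ μ x + μ y
  pr-sum x y = if-elim (λ gs → sum (map ν gs) ≤ μ x + μ y) (leafI x ∨ leafI y)
    (≤-trans (≤-reflexive (+-identityʳ _)) (pair≤ x y))
    (+-mono-≤ (single≤ x) (≤-trans (≤-reflexive (+-identityʳ _)) (single≤ y)))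

  group-sum : ∀ xs → sum (map ν (group xs)) ≤ sum (map μ xs)
  group-sum []                    = z≤n
  group-sum (x ∷ [])              = +-monoˡ-≤ 0 (single≤ x)
  group-sum (x ∷ y ∷ [])          = ≤-trans (pr-sum x y) (≤-reflexive (sym (rearrange₂ (μ x) (μ y))))
  group-sum (x ∷ y ∷ z ∷ [])      =
    if-elim (λ gs → sum (map ν gs) ≤ RHS) (leafI x ∨ leafI y)
      (≤-trans (+-mono-≤ (pair≤ x y) (+-monoˡ-≤ 0 (single≤ z))) (≤-reflexive (assoc₃ (μ x) (μ y) (μ z))))
      (if-elim (λ gs → sum (map ν gs) ≤ RHS) (leafI z)
        (≤-trans (+-mono-≤ (single≤ x) (+-monoˡ-≤ 0 (pair≤ y z))) (≤-reflexive (cong (μ x +_) (assoc₂ (μ y) (μ z)))))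
        (+-mono-≤ (single≤ x) (+-mono-≤ (single≤ y) (+-monoˡ-≤ 0 (single≤ z)))))
    where
    RHS : ℕ
    RHS = μ x + (μ y + (μ z + 0))
    assoc₃ : ∀ a b c → (a + b) + (c + 0) ≡ a + (b + (c + 0))
    assoc₃ = solve-∀
    assoc₂ : ∀ b c → (b + c) + 0 ≡ b + (c + 0)
    assoc₂ = solve-∀
  group-sum (x ∷ y ∷ z ∷ w ∷ xs) = begin
    sum (map ν (pr x y ++ group (z ∷ w ∷ xs)))
      ≡⟨ cong sum (map-++ ν (pr x y) (group (z ∷ w ∷ xs))) ⟩
    sum (map ν (pr x y) ++ map ν (group (z ∷ w ∷ xs)))
      ≡⟨ sum-++ (map ν (pr x y)) _ ⟩
    sum (map ν (pr x y)) + sum (map ν (group (z ∷ w ∷ xs)))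
      ≤⟨ +-mono-≤ (pr-sum x y) (group-sum (z ∷ w ∷ xs)) ⟩
    (μ x + μ y) + sum (map μ (z ∷ w ∷ xs))
      ≡⟨ +-assoc (μ x) (μ y) _ ⟩
    sum (map μ (x ∷ y ∷ z ∷ w ∷ xs)) ∎
    where open ≤-Reasoning

-- A horizontal merge keeps the subtree of only one of its two edges.
mkPair-weight : ∀ x y → stepWeight (mkPair x y) ≤ itemWeight x + itemWeight y
mkPair-weight (w₁ , l₁ , r₁) (w₂ , l₂ , r₂) =
  if-elim (λ g → stepWeight g ≤ (w₁ + rw₁) + (w₂ + rw₂)) l₂
    (≤-trans (≤-reflexive (rearrange w₁ w₂ rw₁)) (+-monoʳ-≤ (w₁ + rw₁) (m≤m+n w₂ rw₂)))
    (≤-trans (≤-reflexive (+-assoc w₁ w₂ rw₂)) (+-monoˡ-≤ (w₂ + rw₂) (m≤m+n w₁ rw₁)))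
  where
  rw₁ rw₂ : ℕ
  rw₁ = resultWeight r₁
  rw₂ = resultWeight r₂
  rearrange : ∀ a b c → (a + b) + c ≡ (a + c) + b
  rearrange = solve-∀

concat-weight : ∀ t top gs → weightL (concatMap (edgesFrom t top) gs) ≤ sum (map stepWeight gs)
concat-weight t top []       = z≤n
concat-weight t top (g ∷ gs) = begin
  weightL (edgesFrom t top g ++ concatMap (edgesFrom t top) gs)
    ≡⟨ weightL-++ (edgesFrom t top g) _ ⟩
  weightL (edgesFrom t top g) + weightL (concatMap (edgesFrom t top) gs)
    ≤⟨ +-mono-≤ (edgesFrom-weight t top g) (concat-weight t top gs) ⟩
  stepWeight g + sum (map stepWeight gs) ∎
  where open ≤-Reasoning

pending-weight : ∀ top gs → openWeight (pending top gs) ≤ sum (map stepWeight gs)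
pending-weight top []          = z≤n
pending-weight top (g ∷ [])    =
  if-elim (λ m → openWeight m ≤ stepWeight g + 0) (is-just (open? (survivor g)) ∧ scheduled top g)
    z≤n
    (≤-trans (+-monoʳ-≤ (size1 g) (m≤m⊔n _ _)) (m≤m+n _ 0))
pending-weight top (_ ∷ _ ∷ _) = z≤n

mutual
  process-weight : ∀ t root S → resultWeight (process t root S) ≤ weight S
  process-weight t root (wnode cs) = begin
    resultWeight (process t root (wnode cs))
      ≡⟨ cong resultWeight (combine-unfold t root gs) ⟩
    weightL (concatMap (edgesFrom t top) gs) ⊔ openWeight (pending top gs)
      ≤⟨ ⊔-lub (concat-weight t top gs) (pending-weight top gs) ⟩
    sum (map stepWeight gs)
      ≤⟨ group-sum itemWeight stepWeight (λ _ → ≤-refl) mkPair-weight (items t cs) ⟩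
    sum (map itemWeight (items t cs))
      ≤⟨ items-weight t cs ⟩
    weightL cs ∎
    where
    open ≤-Reasoning
    gs : List E1
    gs = group (items t cs)
    top : Bool
    top = pathTop root gs

  items-weight : ∀ t cs → sum (map itemWeight (items t cs)) ≤ weightL cs
  items-weight t []             = z≤n
  items-weight t ((w , s) ∷ cs) =
    +-mono-≤ (+-monoʳ-≤ w (process-weight t false s)) (items-weight t cs)

iteration-weight : ∀ t S → weight (iteration t S) ≤ weight S
iteration-weight t S = ≤-trans (m≤m⊔n _ _) (process-weight t true S)

-- Initially every cluster is a single edge of T, so weight = #edges < #nodes.
mutual
  toW-edges : ∀ {A : Set} (T : OTree A) → suc (edgesW (toW T)) ≡ nodes T
  toW-edges (node _ ts) = cong suc (toWs-edges ts)

  toWs-edges : ∀ {A : Set} (ts : List (OTree A)) → edgesL (toWs ts) ≡ nodesL ts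
  toWs-edges []       = refl
  toWs-edges (T ∷ ts) = cong₂ _+_ (toW-edges T) (toWs-edges ts)

mutual
  toW-weight : ∀ {A : Set} (T : OTree A) → weight (toW T) ≡ edgesW (toW T)
  toW-weight (node _ ts) = toWs-weight ts

  toWs-weight : ∀ {A : Set} (ts : List (OTree A)) → weightL (toWs ts) ≡ edgesL (toWs ts)
  toWs-weight []       = refl
  toWs-weight (T ∷ ts) = cong₂ (λ a b → suc (a + b)) (toW-weight T) (toWs-weight ts)

run-weight : ∀ {A : Set} (T : OTree A) k → weight (run k (toW T)) ≤ nodes T
run-weight T zero    = ≤-trans (≤-reflexive (toW-weight T)) (≤-trans (n≤1+n _) (≤-reflexive (toW-edges T)))
run-weight T (suc k) = ≤-trans (iteration-weight (suc k) (run k (toW T))) (run-weight T k)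

mutual
  bigCount : ℕ → WTree → ℕ
  bigCount t (wnode cs) = bigCountL t cs

  bigCountL : ℕ → List (ℕ × WTree) → ℕ
  bigCountL t []             = 0
  bigCountL t ((w , s) ∷ cs) = (big t w + bigCount t s) + bigCountL t cs

sum-scaled-bounds : ∀ a b c p q r X Y → a * X ≤ 2 * p * Y → b * X ≤ 2 * q * Y → c * X ≤ 2 * r * Y →
                    ((a + b) + c) * X ≤ 2 * ((p + q) + r) * Y
sum-scaled-bounds a b c p q r X Y h₁ h₂ h₃ = begin
  ((a + b) + c) * X                     ≡⟨ distrib a b c X ⟩
  (a * X + b * X) + c * X               ≤⟨ +-mono-≤ (+-mono-≤ h₁ h₂) h₃ ⟩
  (2 * p * Y + 2 * q * Y) + 2 * r * Y   ≡⟨ distrib₂ p q r Y ⟩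
  2 * ((p + q) + r) * Y                 ∎
  where
  open ≤-Reasoning
  distrib : ∀ a b c X → ((a + b) + c) * X ≡ (a * X + b * X) + c * X
  distrib = solve-∀
  distrib₂ : ∀ p q r Y → (2 * p * Y + 2 * q * Y) + 2 * r * Y ≡ 2 * ((p + q) + r) * Y
  distrib₂ = solve-∀

mutual
  bigCount-bound : ∀ t S → bigCount t S * 10 ^ t ≤ 2 * weight S * 9 ^ t
  bigCount-bound t (wnode cs) = bigCountL-bound t cs

  bigCountL-bound : ∀ t cs → bigCountL t cs * 10 ^ t ≤ 2 * weightL cs * 9 ^ t
  bigCountL-bound t []             = z≤n
  bigCountL-bound t ((w , s) ∷ cs) =
    sum-scaled-bounds (big t w) (bigCount t s) (bigCountL t cs) w (weight s) (weightL cs) (10 ^ t) (9 ^ t)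
      (big-size t w) (bigCount-bound t s) (bigCountL-bound t cs)

-- Counting edges

edgesL-++ : ∀ xs ys → edgesL (xs ++ ys) ≡ edgesL xs + edgesL ys
edgesL-++ []             ys = refl
edgesL-++ ((w , s) ∷ xs) ys = cong suc (trans (cong (edgesW s +_) (edgesL-++ xs ys))
                                              (sym (+-assoc (edgesW s) (edgesL xs) (edgesL ys))))

closedEdges : Result → ℕ
closedEdges r = edgesW (closed r)

big-of-unmerged : ∀ t w₁ w₂ → small t w₁ ∧ small t w₂ ≡ false → 1 ≤ big t w₁ + big t w₂
big-of-unmerged t w₁ w₂ unmerged with small t w₁ in small₁
... | false = ≤-trans (≤-reflexive (sym (big-of-large t w₁ small₁))) (m≤m+n (big t w₁) (big t w₂))
... | true  = ≤-trans (≤-reflexive (sym (big-of-large t w₂ unmerged))) (m≤n+m (big t w₂) (big t w₁))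

-- Realizing a horizontal merge yields one edge, or two if it is not applied
-- (which requires a big cluster).
realize-pair-edges : ∀ t w₁ w₂ sd r S →
  edgesL (realize t (pair w₁ w₂ sd r) S) ≤ suc (edgesW S) + (big t w₁ + big t w₂)
realize-pair-edges t w₁ w₂ sd r S with small t w₁ ∧ small t w₂ in merged
realize-pair-edges t w₁ w₂ sd        r S | true  = s≤s (≤-trans (≤-reflexive (+-identityʳ _)) (m≤m+n _ _))
realize-pair-edges t w₁ w₂ rightLeaf r S | false = s≤s (+-monoʳ-≤ (edgesW S) (big-of-unmerged t w₁ w₂ merged))
realize-pair-edges t w₁ w₂ leftLeaf  r S | false =
  s≤s (≤-trans (≤-reflexive (+-comm 1 (edgesW S + 0))) (+-mono-≤ (≤-reflexive (+-identityʳ _)) (big-of-unmerged t w₁ w₂ merged)))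

realize-pair-lower : ∀ t w₁ w₂ sd r S → suc (edgesW S) ≤ edgesL (realize t (pair w₁ w₂ sd r) S)
realize-pair-lower t w₁ w₂ sd r S with small t w₁ ∧ small t w₂
realize-pair-lower t w₁ w₂ sd        r S | true  = s≤s (m≤m+n _ 0)
realize-pair-lower t w₁ w₂ rightLeaf r S | false = s≤s (m≤m+n _ _)
realize-pair-lower t w₁ w₂ leftLeaf  r S | false = s≤s (≤-trans (m≤m+n _ 0) (n≤1+n _))

-- The amortized potential

-- What the pending edge handed up to the parent still costs: nothing if it is
-- small (it will be merged into the parent edge), 4 if it is not, and 3 if
-- there is no pending edge at all.
charge : ℕ → Maybe (ℕ × WTree) → ℕ
charge t nothing        = 3
charge t (just (s , _)) = if small t s then 0 else 4

charge≤4 : ∀ t m → charge t m ≤ 4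
charge≤4 t nothing        = s≤s (s≤s (s≤s z≤n))
charge≤4 t (just (s , _)) = if-elim (_≤ 4) (small t s) z≤n ≤-refl

-- A pending cluster that is not small is big, so its charge is prepaid by its bigness.
charge-big : ∀ t w D → charge t (just (w , D)) ≤ 4 * big t w
charge-big t w D with small t w in small-w
... | true  = z≤n
... | false = ≤-reflexive (sym (cong (4 *_) (big-of-large t w small-w)))

-- A pending edge (s , D) hands up the subtree D, which is strictly smaller than
-- what the node keeps: merging the pending edge upward saves at least one edge.
Fits : Maybe (ℕ × WTree) → ℕ → Set
Fits nothing        n = ⊤
Fits (just (_ , D)) n = suc (edgesW D) ≤ n

-- A processed subtree pays with credit K: 6 per remaining edge plus the charge
-- of its pending edge are covered by K + 1.
Pays : ℕ → Result → ℕ → Set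
Pays t r K = (6 * closedEdges r + charge t (open? r) ≤ K + 1) × Fits (open? r) (closedEdges r)

itemCost : ℕ → ℕ → ℕ → ℕ
itemCost t w K = 5 + 6 * big t w + K

mutual
  credit : ℕ → WTree → ℕ
  credit t (wnode cs) = creditL t cs

  creditL : ℕ → List (ℕ × WTree) → ℕ
  creditL t []             = 0
  creditL t ((w , s) ∷ cs) = itemCost t w (credit t s) + creditL t cs

mutual
  credit-split : ∀ t S → credit t S ≡ 5 * edgesW S + 6 * bigCount t S
  credit-split t (wnode cs) = creditL-split t cs

  creditL-split : ∀ t cs → creditL t cs ≡ 5 * edgesL cs + 6 * bigCountL t cs
  creditL-split t []             = refl
  creditL-split t ((w , s) ∷ cs) = begin
    itemCost t w (credit t s) + creditL t cs
      ≡⟨ cong₂ (λ a b → itemCost t w a + b) (credit-split t s) (creditL-split t cs) ⟩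
    (5 + 6 * big t w + (5 * edgesW s + 6 * bigCount t s)) + (5 * edgesL cs + 6 * bigCountL t cs)
      ≡⟨ regroup (big t w) (edgesW s) (bigCount t s) (edgesL cs) (bigCountL t cs) ⟩
    5 * suc (edgesW s + edgesL cs) + 6 * ((big t w + bigCount t s) + bigCountL t cs) ∎
    where
    open ≡-Reasoning
    regroup : ∀ b e B E B' → (5 + 6 * b + (5 * e + 6 * B)) + (5 * E + 6 * B') ≡ 5 * suc (e + E) + 6 * ((b + B) + B')
    regroup = solve-∀

leafR : Result
leafR = mkResult (wnode []) nothing

data Supported (t : ℕ) : Bool → Result → ℕ → Set where
  leaf  : Supported t true leafR 0
  inner : ∀ {r K} → Pays t r K → Supported t false r K

supported-weak : ∀ {t l r K} → Supported t l r K → 6 * closedEdges r ≤ K + 1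
supported-weak leaf             = z≤n
supported-weak (inner (pays , _)) = ≤-trans (m≤m+n _ _) pays

supported-fits : ∀ {t l r K} → Supported t l r K → Fits (open? r) (closedEdges r)
supported-fits leaf              = tt
supported-fits (inner (_ , fits)) = fits

data Backed (t : ℕ) : List Item → ℕ → Set where
  []  : Backed t [] 0
  _∷_ : ∀ {w l r K xs C} → Supported t l r K → Backed t xs C → Backed t ((w , l , r) ∷ xs) (itemCost t w K + C)

single-edges-noPending : ∀ t top w c {K} → Pays t (mkResult c nothing) K →
  6 * edgesL (edgesFrom t top (single w (mkResult c nothing))) ≤ K + 4
single-edges-noPending t top w c {K} (pays , _) = bound (edgesW c) K pays
  where
  bound : ∀ n K → 6 * n + 3 ≤ K + 1 → 6 * suc (n + 0) ≤ K + 4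
  bound n K h = ≤-shift h 3 0 (solve (n ∷ [])) (solve (K ∷ []))

-- With a pending edge (s , D) below, the vertical merge either happens (and the
-- edges of r not below D disappear), or is blocked by a cluster that is not small.
single-edges-pending : ∀ t top w c s D {K} → Pays t (mkResult c (just (s , D))) K →
  6 * edgesL (edgesFrom t top (single w (mkResult c (just (s , D))))) ≤ 3 + 6 * big t w + K
single-edges-pending t top w c s D {K} (pays , fits) rewrite ∧-zeroʳ top
  with small t s | small t w in small-w
... | true  | true  = merged (edgesW D) (edgesW c) (big t w) K fits pays
  where
  merged : ∀ d n b K → suc d ≤ n → 6 * n + 0 ≤ K + 1 → 6 * suc (d + 0) ≤ 3 + 6 * b + K
  merged d n b K d<n h = begin
    6 * suc (d + 0) ≤⟨ *-monoʳ-≤ 6 (≤-trans (s≤s (≤-reflexive (+-identityʳ d))) d<n) ⟩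
    6 * n           ≤⟨ ≤-shift h 0 (2 + 6 * b) (solve (n ∷ [])) (solve (K ∷ b ∷ [])) ⟩
    3 + 6 * b + K   ∎
    where open ≤-Reasoning
... | true  | false rewrite big-of-large t w small-w = blockedAbove (edgesW c) K pays
  where
  blockedAbove : ∀ n K → 6 * n + 0 ≤ K + 1 → 6 * suc (n + 0) ≤ 3 + 6 * 1 + K
  blockedAbove n K h = ≤-shift h 6 2 (solve (n ∷ [])) (solve (K ∷ []))
... | false | _     = blockedBelow (edgesW c) (big t w) K pays
  where
  blockedBelow : ∀ n b K → 6 * n + 4 ≤ K + 1 → 6 * suc (n + 0) ≤ 3 + 6 * b + K
  blockedBelow n b K h = ≤-shift h 2 (6 * b) (solve (n ∷ [])) (solve (K ∷ b ∷ []))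

innerSingle-top : ∀ t w r {K} → Pays t r K → 6 * edgesL (edgesFrom t true (single w r)) + 1 ≤ itemCost t w K
innerSingle-top t w (mkResult c nothing) {K} pays =
  fromNoPending (edgesL (edgesFrom t true (single w (mkResult c nothing)))) (big t w) K
    (single-edges-noPending t true w c pays)
  where
  fromNoPending : ∀ e b K → 6 * e ≤ K + 4 → 6 * e + 1 ≤ 5 + 6 * b + K
  fromNoPending e b K h = ≤-shift h 1 (6 * b) (solve (e ∷ [])) (solve (K ∷ b ∷ []))
innerSingle-top t w (mkResult c (just (s , D))) {K} pays =
  fromPending (edgesL (edgesFrom t true (single w (mkResult c (just (s , D)))))) (big t w) K
    (single-edges-pending t true w c s D pays)
  where
  fromPending : ∀ e b K → 6 * e ≤ 3 + 6 * b + K → 6 * e + 1 ≤ 5 + 6 * b + K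
  fromPending e b K h = ≤-shift h 1 1 (solve (e ∷ [])) (solve (K ∷ b ∷ []))

single-top : ∀ t w {l r K} → Supported t l r K → 6 * edgesL (edgesFrom t true (single w r)) ≤ itemCost t w K + 1
single-top t w leaf = leafEdge (big t w)
  where
  leafEdge : ∀ b → 6 * 1 ≤ 5 + 6 * b + 0 + 1
  leafEdge b = ≤-shift (z≤n {6 * b}) 6 0 refl (solve (b ∷ []))
single-top t w (inner pays) =
  ≤-trans (m≤m+n _ 1) (≤-trans (innerSingle-top t w _ pays) (m≤m+n _ 1))

single-result : ∀ t g → combine t false (g ∷ []) ≡ mkResult (wnode (edgesFrom t false g)) (pending false (g ∷ []))
single-result t g = trans (combine-unfold t false (g ∷ []))
                          (cong (λ cs → mkResult (wnode cs) (pending false (g ∷ []))) (++-identityʳ _))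

-- Below a non-branching node, a child edge to a leaf becomes the pending edge.
leafSingle-pays : ∀ t w → Pays t (combine t false (single w leafR ∷ [])) (itemCost t w 0 + 0)
leafSingle-pays t w = bound (charge t (just (w , wnode []))) (big t w) (charge-big t w (wnode [])) , s≤s z≤n
  where
  bound : ∀ ch b → ch ≤ 4 * b → 6 * 1 + ch ≤ 5 + 6 * b + 0 + 0 + 1
  bound ch b h = ≤-shift h 6 (2 * b) (+-comm 6 ch) (solve (b ∷ []))

-- Below a non-branching node, a child edge over a paying subtree either becomes
-- the pending edge (no pending edge below) or absorbs the pending edge below.
innerSingle-pays : ∀ t w r {K} → Pays t r K → Pays t (combine t false (single w r ∷ [])) (itemCost t w K + 0)
innerSingle-pays t w r {K} pays =
  subst (λ r′ → Pays t r′ (itemCost t w K + 0)) (sym (single-result t (single w r))) (unfolded r pays)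
  where
  unfolded : ∀ r → Pays t r K →
    Pays t (mkResult (wnode (edgesFrom t false (single w r))) (pending false (single w r ∷ []))) (itemCost t w K + 0)
  unfolded (mkResult c nothing) pays =
    becomesPending (edgesL (edgesFrom t false (single w (mkResult c nothing)))) (charge t (just (w , c))) (big t w) K
      (single-edges-noPending t false w c pays) (charge-big t w c)
    , s≤s (m≤m+n (edgesW c) 0)
    where
    becomesPending : ∀ e ch b K → 6 * e ≤ K + 4 → ch ≤ 4 * b → 6 * e + ch ≤ 5 + 6 * b + K + 0 + 1
    becomesPending e ch b K h₁ h₂ =
      ≤-shift (+-mono-≤ h₁ h₂) 0 (2 * b + 2) (solve (e ∷ ch ∷ [])) (solve (K ∷ b ∷ []))
  unfolded (mkResult c (just (s , D))) pays =
    absorbs (edgesL (edgesFrom t false (single w (mkResult c (just (s , D)))))) (big t w) K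
      (single-edges-pending t false w c s D pays)
    , tt
    where
    absorbs : ∀ e b K → 6 * e ≤ 3 + 6 * b + K → 6 * e + 3 ≤ 5 + 6 * b + K + 0 + 1
    absorbs e b K h = ≤-shift h 3 0 (solve (e ∷ [])) (solve (K ∷ b ∷ []))

pair-edges : ∀ t top w₁ w₂ sd r → Fits (open? r) (closedEdges r) →
  edgesL (edgesFrom t top (pair w₁ w₂ sd r)) ≤ suc (closedEdges r) + (big t w₁ + big t w₂)
pair-edges t top w₁ w₂ sd (mkResult c nothing) _ = realize-pair-edges t w₁ w₂ sd (mkResult c nothing) c
pair-edges t top w₁ w₂ sd (mkResult c (just (s , D))) D<c =
  if-elim (λ cs → edgesL cs ≤ suc (edgesW c) + (big t w₁ + big t w₂))
    (scheduled top (pair w₁ w₂ sd (mkResult c (just (s , D)))) ∧ small t s ∧ small t (w₁ + w₂))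
    (≤-trans (s≤s (≤-reflexive (+-identityʳ _))) (≤-trans D<c (≤-trans (n≤1+n _) (m≤m+n _ _))))
    (realize-pair-edges t w₁ w₂ sd (mkResult c (just (s , D))) c)

-- A horizontal merge of two child edges keeps the subtree of only one of them,
-- which is then covered by the credit of both.
record MergedPair (t : ℕ) (g : E1) (w₁ w₂ K : ℕ) : Set where
  field
    side      : Side
    kept      : Result
    is-pair   : g ≡ pair w₁ w₂ side kept
    kept-weak : 6 * closedEdges kept ≤ K + 1
    kept-fits : Fits (open? kept) (closedEdges kept)

mkPair-merged : ∀ {t w₁ w₂ l₁ l₂ r₁ r₂ K₁ K₂} → Supported t l₁ r₁ K₁ → Supported t l₂ r₂ K₂ → T (l₁ ∨ l₂) →
  MergedPair t (mkPair (w₁ , l₁ , r₁) (w₂ , l₂ , r₂)) w₁ w₂ (K₁ + K₂)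
mkPair-merged {K₁ = K₁} s₁ leaf _ = record
  { side = rightLeaf ; kept = _ ; is-pair = refl
  ; kept-weak = ≤-trans (supported-weak s₁) (≤-reflexive (cong (_+ 1) (sym (+-identityʳ K₁))))
  ; kept-fits = supported-fits s₁ }
mkPair-merged leaf s₂@(inner _) _ = record
  { side = leftLeaf ; kept = _ ; is-pair = refl
  ; kept-weak = supported-weak s₂ ; kept-fits = supported-fits s₂ }
mkPair-merged (inner _) (inner _) ()

pair-top : ∀ {t g w₁ w₂ K₁ K₂} → MergedPair t g w₁ w₂ (K₁ + K₂) →
  6 * edgesL (edgesFrom t true g) + 3 ≤ itemCost t w₁ K₁ + itemCost t w₂ K₂
pair-top {t} {_} {w₁} {w₂} {K₁} {K₂}
    record { side = sd ; kept = r ; is-pair = refl ; kept-weak = weak ; kept-fits = fits } =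
  bound _ (closedEdges r) (big t w₁) (big t w₂) K₁ K₂ (pair-edges t true w₁ w₂ sd r fits) weak
  where
  bound : ∀ e n b₁ b₂ K₁ K₂ → e ≤ suc n + (b₁ + b₂) → 6 * n ≤ K₁ + K₂ + 1 →
          6 * e + 3 ≤ (5 + 6 * b₁ + K₁) + (5 + 6 * b₂ + K₂)
  bound e n b₁ b₂ K₁ K₂ h₁ h₂ = begin
    6 * e + 3                         ≤⟨ +-monoˡ-≤ 3 (*-monoʳ-≤ 6 h₁) ⟩
    6 * (suc n + (b₁ + b₂)) + 3       ≤⟨ ≤-shift h₂ (9 + 6 * b₁ + 6 * b₂) 0 (solve (n ∷ b₁ ∷ b₂ ∷ [])) (solve (K₁ ∷ K₂ ∷ b₁ ∷ b₂ ∷ [])) ⟩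
    (5 + 6 * b₁ + K₁) + (5 + 6 * b₂ + K₂) ∎
    where open ≤-Reasoning

-- Below a non-branching node, a merged pair either becomes the pending edge or
-- absorbs the pending edge below it.
pair-pays : ∀ {t g w₁ w₂ K₁ K₂} → MergedPair t g w₁ w₂ (K₁ + K₂) →
  Pays t (combine t false (g ∷ [])) (itemCost t w₁ K₁ + (itemCost t w₂ K₂ + 0))
pair-pays {t} {_} {w₁} {w₂} {K₁} {K₂}
    record { side = sd ; kept = r ; is-pair = refl ; kept-weak = weak ; kept-fits = fits } =
  subst (λ r′ → Pays t r′ (itemCost t w₁ K₁ + (itemCost t w₂ K₂ + 0))) (sym (single-result t g))
    ( bound (edgesL (edgesFrom t false g)) (charge t (pending false (g ∷ []))) (closedEdges r) (big t w₁) (big t w₂) K₁ K₂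
        (pair-edges t false w₁ w₂ sd r fits) (charge≤4 t (pending false (g ∷ []))) weak
    , pending-fits r)
  where
  g : E1
  g = pair w₁ w₂ sd r
  bound : ∀ e ch n b₁ b₂ K₁ K₂ → e ≤ suc n + (b₁ + b₂) → ch ≤ 4 → 6 * n ≤ K₁ + K₂ + 1 →
          6 * e + ch ≤ (5 + 6 * b₁ + K₁) + ((5 + 6 * b₂ + K₂) + 0) + 1
  bound e ch n b₁ b₂ K₁ K₂ h₁ h₂ h₃ = begin
    6 * e + ch                        ≤⟨ +-mono-≤ (*-monoʳ-≤ 6 h₁) h₂ ⟩
    6 * (suc n + (b₁ + b₂)) + 4       ≤⟨ ≤-shift h₃ (10 + 6 * b₁ + 6 * b₂) 0 (solve (n ∷ b₁ ∷ b₂ ∷ [])) (solve (K₁ ∷ K₂ ∷ b₁ ∷ b₂ ∷ [])) ⟩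
    (5 + 6 * b₁ + K₁) + ((5 + 6 * b₂ + K₂) + 0) + 1 ∎
    where open ≤-Reasoning
  pending-fits : ∀ r → Fits (pending false (pair w₁ w₂ sd r ∷ [])) (edgesL (edgesFrom t false (pair w₁ w₂ sd r)))
  pending-fits (mkResult c nothing)  = realize-pair-lower t w₁ w₂ sd (mkResult c nothing) c
  pending-fits (mkResult c (just _)) = tt

branchEdges : ℕ → List E1 → ℕ
branchEdges t gs = edgesL (concatMap (edgesFrom t true) gs)

branchEdges-++ : ∀ t gs hs → branchEdges t (gs ++ hs) ≡ branchEdges t gs + branchEdges t hs
branchEdges-++ t gs hs = begin
  edgesL (concat (map f (gs ++ hs)))            ≡⟨ cong (λ xss → edgesL (concat xss)) (map-++ f gs hs) ⟩
  edgesL (concat (map f gs ++ map f hs))        ≡⟨ cong edgesL (sym (concat-++ (map f gs) (map f hs))) ⟩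
  edgesL (concatMap f gs ++ concatMap f hs)     ≡⟨ edgesL-++ (concatMap f gs) (concatMap f hs) ⟩
  branchEdges t gs + branchEdges t hs           ∎
  where
  open ≡-Reasoning
  f : E1 → List (ℕ × WTree)
  f = edgesFrom t true

branchEdges-∷ : ∀ {t g gs a b c d} → 6 * edgesL (edgesFrom t true g) + a ≤ c → 6 * branchEdges t gs + b ≤ d →
  6 * branchEdges t (g ∷ gs) + (a + b) ≤ c + d
branchEdges-∷ {t} {g} {gs} {a} {b} {c} {d} h₁ h₂ = begin
  6 * branchEdges t (g ∷ gs) + (a + b)  ≡⟨ cong (λ n → 6 * n + (a + b)) (edgesL-++ (edgesFrom t true g) _) ⟩
  6 * (e + E) + (a + b)                 ≡⟨ regroup e E a b ⟩
  (6 * e + a) + (6 * E + b)             ≤⟨ +-mono-≤ h₁ h₂ ⟩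
  c + d                                 ∎
  where
  open ≤-Reasoning
  e E : ℕ
  e = edgesL (edgesFrom t true g)
  E = branchEdges t gs
  regroup : ∀ e E a b → 6 * (e + E) + (a + b) ≡ (6 * e + a) + (6 * E + b)
  regroup = solve-∀

merged-top : ∀ {t g w₁ w₂ K₁ K₂} → MergedPair t g w₁ w₂ (K₁ + K₂) →
  6 * branchEdges t (g ∷ []) + 2 ≤ itemCost t w₁ K₁ + itemCost t w₂ K₂
merged-top {t} {g} m = ≤-trans (+-monoʳ-≤ _ (n≤1+n 2))
  (≤-trans (branchEdges-∷ {t} {g} {[]} (pair-top m) z≤n) (≤-reflexive (+-identityʳ _)))

-- Two child edges at a branching node leave slack 2: either they are merged
-- (slack 3) or both are over paying subtrees (slack 1 each).
pr-top : ∀ {t w₁ w₂ l₁ l₂ r₁ r₂ K₁ K₂} → Supported t l₁ r₁ K₁ → Supported t l₂ r₂ K₂ →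
  6 * branchEdges t (pr (w₁ , l₁ , r₁) (w₂ , l₂ , r₂)) + 2 ≤ itemCost t w₁ K₁ + itemCost t w₂ K₂
pr-top s₁@leaf      s₂          = merged-top (mkPair-merged s₁ s₂ tt)
pr-top s₁@(inner _) s₂@leaf     = merged-top (mkPair-merged s₁ s₂ tt)
pr-top {t} {w₁} {w₂} {r₁ = r₁} {r₂} {K₁} {K₂} (inner p₁) (inner p₂) =
  ≤-trans (branchEdges-∷ {t} {single w₁ r₁} {single w₂ r₂ ∷ []} (innerSingle-top t w₁ r₁ p₁)
            (branchEdges-∷ {t} {single w₂ r₂} {[]} (innerSingle-top t w₂ r₂ p₂) z≤n))
          (≤-reflexive (cong (itemCost t w₁ K₁ +_) (+-identityʳ (itemCost t w₂ K₂))))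

weaken-slack : ∀ E {a b C C′} → b ≤ a → 6 * E + a ≤ C → C ≡ C′ → 6 * E + b ≤ C′
weaken-slack E b≤a h refl = ≤-trans (+-monoʳ-≤ (6 * E) b≤a) h

-- A merged pair followed by an unmerged edge leaves slack 2: the pair's slack 3
-- covers the deficit 1 of an edge to a leaf.
pair-then-single : ∀ {t g w₁ w₂ w₃ l₃ r₃ K₁ K₂ K₃} → MergedPair t g w₁ w₂ (K₁ + K₂) → Supported t l₃ r₃ K₃ →
  6 * branchEdges t (g ∷ single w₃ r₃ ∷ []) + 2 ≤ itemCost t w₁ K₁ + (itemCost t w₂ K₂ + (itemCost t w₃ K₃ + 0))
pair-then-single {t} {g} {w₁} {w₂} {w₃} {r₃ = r₃} {K₁} {K₂} {K₃} m s₃ =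
  rebalance (branchEdges t (g ∷ single w₃ r₃ ∷ [])) (itemCost t w₁ K₁) (itemCost t w₂ K₂) (itemCost t w₃ K₃)
    (branchEdges-∷ {t} {g} {single w₃ r₃ ∷ []} (pair-top m)
      (branchEdges-∷ {t} {single w₃ r₃} {[]} (≤-trans (≤-reflexive (+-identityʳ _)) (single-top t w₃ s₃)) z≤n))
  where
  rebalance : ∀ E c₁ c₂ c₃ → 6 * E + (3 + (0 + 0)) ≤ (c₁ + c₂) + ((c₃ + 1) + 0) → 6 * E + 2 ≤ c₁ + (c₂ + (c₃ + 0))
  rebalance E c₁ c₂ c₃ h = +-cancelʳ-≤ 1 (6 * E + 2) (c₁ + (c₂ + (c₃ + 0))) (begin
    6 * E + 2 + 1                   ≡⟨ solve (E ∷ []) ⟩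
    6 * E + (3 + (0 + 0))           ≤⟨ h ⟩
    (c₁ + c₂) + ((c₃ + 1) + 0)      ≡⟨ solve (c₁ ∷ c₂ ∷ c₃ ∷ []) ⟩
    c₁ + (c₂ + (c₃ + 0)) + 1        ∎)
    where open ≤-Reasoning

triple-top : ∀ {t w₁ w₂ w₃ l₁ l₂ l₃ r₁ r₂ r₃ K₁ K₂ K₃} →
  Supported t l₁ r₁ K₁ → Supported t l₂ r₂ K₂ → Supported t l₃ r₃ K₃ →
  6 * branchEdges t (group ((w₁ , l₁ , r₁) ∷ (w₂ , l₂ , r₂) ∷ (w₃ , l₃ , r₃) ∷ [])) + 2
    ≤ itemCost t w₁ K₁ + (itemCost t w₂ K₂ + (itemCost t w₃ K₃ + 0))
triple-top s₁@leaf      s₂      s₃ = pair-then-single (mkPair-merged s₁ s₂ tt) s₃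
triple-top s₁@(inner _) s₂@leaf s₃ = pair-then-single (mkPair-merged s₁ s₂ tt) s₃
triple-top {t} {w₁} {w₂} {w₃} {r₁ = r₁} {r₂} {K₁ = K₁} {K₂} (inner p₁) s₂@(inner _) s₃@leaf =
  weaken-slack (branchEdges t (single w₁ r₁ ∷ g₂₃ ∷ [])) (s≤s (s≤s z≤n))
    (branchEdges-∷ {t} {single w₁ r₁} {g₂₃ ∷ []} (innerSingle-top t w₁ r₁ p₁)
      (branchEdges-∷ {t} {g₂₃} {[]} (pair-top (mkPair-merged s₂ s₃ tt)) z≤n))
    (cong (itemCost t w₁ K₁ +_) (+-assoc (itemCost t w₂ K₂) (itemCost t w₃ 0) 0))
  where
  g₂₃ : E1
  g₂₃ = mkPair (w₂ , false , r₂) (w₃ , true , leafR)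
triple-top {t} {w₁} {w₂} {w₃} {r₁ = r₁} {r₂} {r₃} (inner p₁) (inner p₂) (inner p₃) =
  weaken-slack (branchEdges t (single w₁ r₁ ∷ single w₂ r₂ ∷ single w₃ r₃ ∷ [])) (s≤s (s≤s z≤n))
    (branchEdges-∷ {t} {single w₁ r₁} {single w₂ r₂ ∷ single w₃ r₃ ∷ []} (innerSingle-top t w₁ r₁ p₁)
      (branchEdges-∷ {t} {single w₂ r₂} {single w₃ r₃ ∷ []} (innerSingle-top t w₂ r₂ p₂)
        (branchEdges-∷ {t} {single w₃ r₃} {[]} (innerSingle-top t w₃ r₃ p₃) z≤n)))
    refl

-- Two or more child edges at a node leave slack 2 in total: step (1) handles
-- them in pairs, and an odd last edge is grouped with the pair before it.
group-top : ∀ {t x y xs C} → Backed t (x ∷ y ∷ xs) C → 6 * branchEdges t (group (x ∷ y ∷ xs)) + 2 ≤ C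
group-top {t} {x} {y} (_∷_ {K = K₁} s₁ (_∷_ {K = K₂} s₂ [])) =
  weaken-slack (branchEdges t (pr x y)) ≤-refl (pr-top s₁ s₂)
    (cong (itemCost t (proj₁ x) K₁ +_) (sym (+-identityʳ (itemCost t (proj₁ y) K₂))))
group-top (s₁ ∷ s₂ ∷ s₃ ∷ []) = triple-top s₁ s₂ s₃
group-top {t} {x} {y} {z ∷ w ∷ xs} (_∷_ {K = K₁} s₁ (_∷_ {K = K₂} {C = C′} s₂ rest@(_ ∷ _ ∷ _))) = begin
  6 * branchEdges t (pr x y ++ group (z ∷ w ∷ xs)) + 2
    ≡⟨ cong (λ n → 6 * n + 2) (branchEdges-++ t (pr x y) (group (z ∷ w ∷ xs))) ⟩
  6 * (E₁ + E₂) + 2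
    ≤⟨ +-monoʳ-≤ (6 * (E₁ + E₂)) (m≤m+n 2 2) ⟩
  6 * (E₁ + E₂) + 4
    ≡⟨ regroup E₁ E₂ ⟩
  (6 * E₁ + 2) + (6 * E₂ + 2)
    ≤⟨ +-mono-≤ (pr-top s₁ s₂) (group-top rest) ⟩
  (c₁ + c₂) + C′
    ≡⟨ +-assoc c₁ c₂ C′ ⟩
  c₁ + (c₂ + C′) ∎
  where
  open ≤-Reasoning
  E₁ E₂ c₁ c₂ : ℕ
  E₁ = branchEdges t (pr x y)
  E₂ = branchEdges t (group (z ∷ w ∷ xs))
  c₁ = itemCost t (proj₁ x) K₁
  c₂ = itemCost t (proj₁ y) K₂
  regroup : ∀ a b → 6 * (a + b) + 4 ≡ (6 * a + 2) + (6 * b + 2)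
  regroup = solve-∀

pr-nonempty : ∀ x y → 1 ≤ length (pr x y)
pr-nonempty x y = if-elim (λ gs → 1 ≤ length gs) (leafI x ∨ leafI y) (s≤s z≤n) (s≤s z≤n)

mutual
  group-nonempty : ∀ x y xs → 1 ≤ length (group (x ∷ y ∷ xs))
  group-nonempty x y []       = pr-nonempty x y
  group-nonempty x y (z ∷ xs) = ≤-trans (s≤s z≤n) (group-long x y z xs)

  group-long : ∀ x y z xs → 2 ≤ length (group (x ∷ y ∷ z ∷ xs))
  group-long x y z [] =
    if-elim (λ gs → 2 ≤ length gs) (leafI x ∨ leafI y) ≤-refl
      (if-elim (λ gs → 2 ≤ length gs) (leafI z) ≤-refl (s≤s (s≤s z≤n)))
  group-long x y z (w ∷ xs) = begin
    2                                               ≤⟨ +-mono-≤ (pr-nonempty x y) (group-nonempty z w xs) ⟩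
    length (pr x y) + length (group (z ∷ w ∷ xs))   ≡⟨ sym (length-++ (pr x y)) ⟩
    length (pr x y ++ group (z ∷ w ∷ xs))           ∎
    where open ≤-Reasoning

branching-pays : ∀ {t C} gs → 2 ≤ length gs → 6 * branchEdges t gs + 2 ≤ C → Pays t (combine t false gs) C
branching-pays []             ()               _
branching-pays (_ ∷ [])       (s≤s ())         _
branching-pays {t} {C} (g₁ ∷ g₂ ∷ gs) _ h =
  subst (λ r → Pays t r C) (sym (combine-unfold t false (g₁ ∷ g₂ ∷ gs)))
    (≤-trans (≤-reflexive (sym (+-assoc _ 2 1))) (+-monoˡ-≤ 1 h) , tt)

node-pays : ∀ {t x xs C} → Backed t (x ∷ xs) C → Pays t (combine t false (group (x ∷ xs))) C
node-pays {t} {w , _ , _} (leaf ∷ [])          = leafSingle-pays t w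
node-pays {t} {w , _ , r} (inner pays ∷ [])    = innerSingle-pays t w r pays
node-pays (s₁@leaf ∷ s₂ ∷ [])                  = pair-pays (mkPair-merged s₁ s₂ tt)
node-pays (s₁@(inner _) ∷ s₂@leaf ∷ [])        = pair-pays (mkPair-merged s₁ s₂ tt)
node-pays {x = x} {y ∷ []} b@(inner _ ∷ inner _ ∷ [])  = branching-pays (pr x y) (s≤s (s≤s z≤n)) (group-top b)
node-pays {x = x} {y ∷ z ∷ xs} b@(_ ∷ _ ∷ _ ∷ _) = branching-pays (group (x ∷ y ∷ z ∷ xs)) (group-long x y z xs) (group-top b)

children-backed : ∀ t cs → Backed t (items t cs) (creditL t cs)
children-backed t []                              = []
children-backed t ((w , wnode []) ∷ cs)           = leaf ∷ children-backed t cs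
children-backed t ((w , wnode cs′@(_ ∷ _)) ∷ cs) = inner (node-pays (children-backed t cs′)) ∷ children-backed t cs

root-edges : ∀ t gs → edgesW (closed (combine t true gs)) ≡ branchEdges t gs
root-edges t gs = trans (cong (λ r → edgesW (closed r)) (combine-unfold t true gs))
                        (cong (λ b → edgesL (concatMap (edgesFrom t b) gs)) (cong not (∧-zeroʳ (length gs ≡ᵇ 1))))

root-bound : ∀ t S → 2 ≤ edgesW S → 6 * edgesW (iteration t S) ≤ credit t S
root-bound t (wnode cs) two =
  ≤-trans (≤-reflexive (cong (6 *_) (root-edges t (group (items t cs))))) (below-root cs two)
  where
  below-root : ∀ cs → 2 ≤ edgesL cs → 6 * branchEdges t (group (items t cs)) ≤ creditL t cs
  below-root ((w , wnode []) ∷ [])           (s≤s ())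
  below-root ((w , wnode cs′@(_ ∷ _)) ∷ [])  _ =
    ≤-trans (m≤m+n _ 1)
      (branchEdges-∷ {t} {single w (process t false (wnode cs′))} {[]}
        (innerSingle-top t w _ (node-pays (children-backed t cs′))) z≤n)
  below-root (c₁ ∷ c₂ ∷ cs′) _ = ≤-trans (m≤m+n _ 2) (group-top (children-backed t (c₁ ∷ c₂ ∷ cs′)))

contraction : ∀ t S → 2 ≤ edgesW S → 6 * edgesW (iteration t S) ≤ 5 * edgesW S + 6 * bigCount t S
contraction t S two = ≤-trans (root-bound t S two) (≤-reflexive (credit-split t S))

at-most-one-edge : ∀ t S → edgesW S ≤ 1 → edgesW (iteration t S) ≤ 1
at-most-one-edge t (wnode [])                            _       = z≤n
at-most-one-edge t (wnode ((w , wnode []) ∷ []))         _       = ≤-refl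
at-most-one-edge t (wnode ((w , wnode (_ ∷ _)) ∷ _))     (s≤s ())
at-most-one-edge t (wnode ((_ , s₁) ∷ (_ , s₂) ∷ cs))    (s≤s h) =
  ⊥-elim (n≮0 (≤-trans (m≤n+m (suc (edgesW s₂ + edgesL cs)) (edgesW s₁)) h))

Bounded : ∀ {A : Set} → OTree A → ℕ → Set
Bounded T k = edgesW (run k (toW T)) * 10 ^ k ≤ 27 * nodes T * 9 ^ k

recurrence : ∀ E′ E B W n a b → 6 * E′ ≤ 5 * E + 6 * B → E * a ≤ 27 * n * b →
             B * (10 * a) ≤ 2 * W * (9 * b) → W ≤ n → E′ * (10 * a) ≤ 27 * n * (9 * b)
recurrence E′ E B W n a b contract bounded few-big light = *-cancelˡ-≤ 6 (begin
  6 * (E′ * (10 * a))                          ≡⟨ solve (E′ ∷ a ∷ []) ⟩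
  (6 * E′) * (10 * a)                          ≤⟨ *-monoˡ-≤ (10 * a) contract ⟩
  (5 * E + 6 * B) * (10 * a)                   ≡⟨ solve (E ∷ B ∷ a ∷ []) ⟩
  50 * (E * a) + 6 * (B * (10 * a))            ≤⟨ +-mono-≤ (*-monoʳ-≤ 50 bounded) (*-monoʳ-≤ 6 few-big) ⟩
  50 * (27 * n * b) + 6 * (2 * W * (9 * b))    ≤⟨ +-monoʳ-≤ (50 * (27 * n * b)) (*-monoʳ-≤ 6 (*-monoˡ-≤ (9 * b) (*-monoʳ-≤ 2 light))) ⟩
  50 * (27 * n * b) + 6 * (2 * n * (9 * b))    ≡⟨ solve (n ∷ b ∷ []) ⟩
  6 * (27 * n * (9 * b))                       ∎)
  where open ≤-Reasoning

bounded-step : ∀ {A : Set} (T : OTree A) k → 2 ≤ edgesW (run k (toW T)) → Bounded T k → Bounded T (suc k)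
bounded-step T k two bounded =
  recurrence (edgesW (run (suc k) (toW T))) (edgesW S) (bigCount (suc k) S) (weight S) (nodes T) (10 ^ k) (9 ^ k)
    (contraction (suc k) S two) bounded (bigCount-bound (suc k) S) (run-weight T k)
  where
  S : WTree
  S = run k (toW T)

run-bound : ∀ {A : Set} (T : OTree A) k → edgesW (run k (toW T)) ≤ 1 ⊎ Bounded T k
run-bound T zero = inj₂ (initial (edgesW (toW T)) (nodes T) (≤-reflexive (toW-edges T)))
  where
  initial : ∀ e n → suc e ≤ n → e * 1 ≤ 27 * n * 1
  initial e n h = ≤-shift (≤-trans (n≤1+n e) h) 0 (26 * n) (solve (e ∷ [])) (solve (n ∷ []))
run-bound T (suc k) with edgesW (run k (toW T)) ≤? 1
... | yes at-most-one = inj₁ (at-most-one-edge (suc k) (run k (toW T)) at-most-one)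
... | no  more-edges  = inj₂ (bounded-step T k (≰⇒> more-edges) (fromInj₂ (λ h → ⊥-elim (more-edges h)) (run-bound T k)))

bounded-while-large : ∀ {A : Set} (T : OTree A) k → 2 ≤ edgesW (run k (toW T)) → Bounded T k
bounded-while-large T k two = fromInj₂ (λ at-most-one → ⊥-elim (<⇒≱ two at-most-one)) (run-bound T k)

absorb-factor : ∀ E n a b → E * a ≤ 27 * n * b → E * (10 * a) ≤ 270 * n * (9 * b)
absorb-factor E n a b h = begin
  E * (10 * a)          ≡⟨ solve (E ∷ a ∷ []) ⟩
  10 * (E * a)          ≤⟨ *-monoʳ-≤ 10 h ⟩
  10 * (27 * n * b)     ≤⟨ ≤-shift (z≤n {2160 * n * b}) (270 * n * b) 0 (solve (n ∷ b ∷ [])) (solve (n ∷ b ∷ [])) ⟩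
  270 * n * (9 * b)     ∎
  where open ≤-Reasoning

lemma4 : ∃[ C ] (∀ {A : Set} (T : OTree A) (t : ℕ) → 1 ≤ t
           → 2 ≤ edgesW (run (t ∸ 1) (toW T))
           → edgesW (run t (toW T)) * 10 ^ (suc t) ≤ C * nodes T * 9 ^ (suc t))
lemma4 = 270 , after-iteration
  where
  after-iteration : ∀ {A : Set} (T : OTree A) (t : ℕ) → 1 ≤ t → 2 ≤ edgesW (run (t ∸ 1) (toW T)) →
                    edgesW (run t (toW T)) * 10 ^ (suc t) ≤ 270 * nodes T * 9 ^ (suc t)
  after-iteration T zero    () _
  after-iteration T (suc k) _ two =
    absorb-factor (edgesW (run (suc k) (toW T))) (nodes T) (10 ^ suc k) (9 ^ suc k)
      (bounded-step T k two (bounded-while-large T k two))
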